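{- Let $\lambda$ be a partition with $\lambda_1=2$ (two columns, of lengths $p=\zeta_1\ge q=\zeta_2$), $z$ a content with $|z|=|\lambda|$, and $F,S$ cardinal fillings of shape $\lambda$ and content $z$. For $1\le l\le p$ let $F_l$ be the filling obtained from $F$ by exchanging the top entry of column $2$ with the $l$-th entry of column $1$. Then $$R(F,S)-\sum_{l=1}^pR(F_l,S)=0.$$
   Context: Fix $n\ge 2$. A partition $\lambda$ is identified with its Young diagram with column lengths $\zeta_1\ge\cdots\ge\zeta_{\lambda_1}$; $(r,c)$ is the box in row $r$, column $c$. A filling of shape $\lambda$ assigns a value in $\{1,\dots,n\}$ to each box; its content counts occurrences of each value. Cardinal: no repeated value in a column. Same row content: for each row, the multisets of entries of that row agree. $\mathfrak{S}_\lambda=\prod_c\mathfrak{S}_{\zeta_c}$ acts by $F_{\underline\pi}(r,c)=F(\pi_c(r),c)$, with $\mathrm{sgn}(\underline\pi)=\prod_c\mathrm{sgn}(\pi_c)$. $R(F,S)=\sum\mathrm{sgn}(\underline\pi)$ over all $\underline\pi\in\mathfrak{S}_\lambda$ such that $F_{\underline\pi}$ has the same row content as $S$. -}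

module Defs where

open import Data.Nat as ℕ using (ℕ; zero; suc; _<_; _<?_)
open import Data.Fin as Fin using (Fin; zero; suc; toℕ; fromℕ<; _≟_)
open import Data.Fin.Properties using (all?)
open import Data.List using (List; []; _∷_; [_]; map; concatMap; allFin; filter; length; foldr)
open import Data.Integer as ℤ using (ℤ; 0ℤ; 1ℤ; -1ℤ)
open import Data.Product using (_×_; _,_; proj₁; proj₂)
open import Data.Bool using (if_then_else_)
open import Relation.Nullary using (Dec; yes; no; does; ¬_)
open import Relation.Nullary.Decidable using (¬?)
open import Relation.Binary.PropositionalEquality using (_≡_)
open import Function.Definitions using (Injective)

sumℤ : List ℤ → ℤ
sumℤ = foldr ℤ._+_ 0ℤ

sumℕ : List ℕ → ℕ
sumℕ = foldr ℕ._+_ 0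

allFuns : (m k : ℕ) → List (Fin m → Fin k)
allFuns zero    k = [ (λ ()) ]
allFuns (suc m) k =
  concatMap (λ f → map (λ i → λ { zero → i ; (suc x) → f x }) (allFin k))
            (allFuns m k)

injective? : ∀ {m k} (f : Fin m → Fin k) → Dec (∀ i j → f i ≡ f j → i ≡ j)
injective? f = all? (λ i → all? (λ j → dec i j))
  where
  dec : ∀ i j → Dec (f i ≡ f j → i ≡ j)
  dec i j with f i ≟ f j | i ≟ j
  ... | _      | yes e = yes (λ _ → e)
  ... | yes e  | no ne = no (λ h → ne (h e))
  ... | no ne  | no _  = yes (λ e → Data.Empty.⊥-elim (ne e))
    where import Data.Empty

perms : (m : ℕ) → List (Fin m → Fin m)
perms m = filter injective? (allFuns m m)

inversions : ∀ {m} → (Fin m → Fin m) → ℕ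
inversions {m} π =
  length (filter (λ ij → Fin._<?_ (π (proj₂ ij)) (π (proj₁ ij)))
            (filter (λ ij → Fin._<?_ (proj₁ ij) (proj₂ ij))
              (concatMap (λ i → map (λ j → (i , j)) (allFin m)) (allFin m))))

sgn : ∀ {m} → (Fin m → Fin m) → ℤ
sgn π = -1ℤ ℤ.^ inversions π

-- Fillings of the two-column shape with column lengths p ≥ q,
-- values in {1,…,n} represented as Fin n.
-- Box (r , 1) ↦ col₁ r  (r : Fin p),  box (r , 2) ↦ col₂ r (r : Fin q).
-- Rows are indexed by Fin p; row r contains the column-2 box iff r < q.

record Filling (n p q : ℕ) : Set where
  constructor filling
  field
    col₁ : Fin p → Fin n
    col₂ : Fin q → Fin n
open Filling public

occ : ∀ {n} → Fin n → List (Fin n) → ℕ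
occ v xs = length (filter (_≟ v) xs)

content : ∀ {n p q} → Filling n p q → Fin n → ℕ
content {p = p} {q} F v =
  occ v (map (col₁ F) (allFin p)) ℕ.+ occ v (map (col₂ F) (allFin q))

Cardinal : ∀ {n p q} → Filling n p q → Set
Cardinal F = Injective _≡_ _≡_ (col₁ F) × Injective _≡_ _≡_ (col₂ F)

rowEntries : ∀ {n p q} → Filling n p q → Fin p → List (Fin n)
rowEntries {q = q} F r with toℕ r <? q
... | yes h = col₁ F r ∷ col₂ F (fromℕ< h) ∷ []
... | no _  = col₁ F r ∷ []

rowContent : ∀ {n p q} → Filling n p q → Fin p → Fin n → ℕ
rowContent F r v = occ v (rowEntries F r)

SameRowContent : ∀ {n p q} → Filling n p q → Filling n p q → Set
SameRowContent F S = ∀ r v → rowContent F r v ≡ rowContent S r v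

sameRowContent? : ∀ {n p q} (F S : Filling n p q) → Dec (SameRowContent F S)
sameRowContent? F S =
  all? (λ r → all? (λ v → ℕ._≟_ (rowContent F r v) (rowContent S r v)))

act : ∀ {n p q} → Filling n p q → (Fin p → Fin p) → (Fin q → Fin q) → Filling n p q
act F π₁ π₂ = filling (λ r → col₁ F (π₁ r)) (λ r → col₂ F (π₂ r))

R : ∀ {n p q} → Filling n p q → Filling n p q → ℤ
R {p = p} {q} F S =
  sumℤ (concatMap (λ π₁ → map (λ π₂ →
          if does (sameRowContent? (act F π₁ π₂) S)
            then sgn π₁ ℤ.* sgn π₂ else 0ℤ)
        (perms q)) (perms p))

exchange : ∀ {n p q} → 0 < q → Filling n p q → Fin p → Filling n p q
exchange {q = q} h F l = filling c₁ c₂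
  where
  top : Fin q
  top = fromℕ< h
  c₁ : _
  c₁ r with r ≟ l
  ... | yes _ = col₂ F top
  ... | no _  = col₁ F r
  c₂ : _
  c₂ r with r ≟ top
  ... | yes _ = col₁ F l
  ... | no _  = col₂ F r

-- Write R(F, S) as a signed double sum over (π₁, π₂) ∈ 𝔖_p × 𝔖_q. Fix π₂ and let t be the box
-- of column 2 that π₂ moves to the top, j its row. Reindexing l = π₁ i, the filling F_l acted on
-- by (π₁, π₂) is F_(π₁,π₂) with the entries of the boxes (i, 1) and (t, 2) exchanged. For i = j
-- both entries lie in row j, so nothing changes row-wise and these terms sum to R(F, S). For
-- i ≠ j, replacing π₁ by π₁ ∘ (i j) only swaps the two entries of row j but flips sgn π₁, so
-- these terms cancel in pairs. The sign flip is an inversion count: an adjacent transposition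
-- changes the number of inversions by exactly one, and (i j) is conjugate to (i j-1) by an
-- adjacent transposition.

module Submission where

open import Defs
open import Data.Nat as ℕ using (ℕ; zero; suc)
import Data.Nat.Properties as ℕₚ
open import Data.Fin using (Fin; zero; suc; toℕ; fromℕ<; inject₁; inject≤; punchOut; _≟_)
import Data.Fin.Properties as Finₚ
open import Data.Fin.Permutation.Components using (transpose; transpose-inverse)
open import Data.List using (List; []; _∷_; map; concatMap; allFin; filter; length; _++_)
open import Data.List.Properties using (map-tabulate; map-concatMap)
open import Data.List.Membership.Propositional using (_∈_)
open import Data.List.Membership.Propositional.Properties using (∈-filter⁻)
open import Data.List.Relation.Unary.Any using (here; there)
open import Data.List.Relation.Binary.Permutation.Propositional using (↭-swap; ↭-refl)
open import Data.List.Relation.Binary.Permutation.Propositional.Properties using (↭-length; filter-↭)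
open import Data.Integer as ℤ using (ℤ; 0ℤ; 1ℤ; -1ℤ; _*_; -_)
import Data.Integer.Properties as ℤₚ
open import Data.Bool using (Bool; true; false; if_then_else_; _∧_)
open import Data.Product using (_×_; _,_; proj₁; proj₂; ∃)
open import Relation.Nullary using (Dec; yes; no; does; ¬_; contradiction)
open import Relation.Nullary.Decidable using (dec-true; dec-false; does-⇔)
open import Relation.Binary.Core using (Rel; _Preserves_⟶_)
open import Relation.Binary.Definitions using (Decidable; tri<; tri≈; tri>)
open import Relation.Binary.PropositionalEquality
open import Function using (_∘_; id; _⇔_; mk⇔)
open import Function.Definitions using (Injective)

module FiniteSums where

  open import Data.Integer using (_+_)
  open import Algebra.Properties.CommutativeSemigroup ℤₚ.+-commutativeSemigroup using () renaming (interchange to +-interchange)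

  𝟙 : Bool → ℤ
  𝟙 b = if b then 1ℤ else 0ℤ

  𝟙-∧ : ∀ a b → 𝟙 (a ∧ b) ≡ 𝟙 a * 𝟙 b
  𝟙-∧ true  b = sym (ℤₚ.*-identityˡ (𝟙 b))
  𝟙-∧ false b = refl

  Σ : ∀ {a} {A : Set a} → List A → (A → ℤ) → ℤ
  Σ xs f = sumℤ (map f xs)

  module _ {a} {A : Set a} where

    Σ-cong-∈ : ∀ (xs : List A) {f g : A → ℤ} → (∀ {x} → x ∈ xs → f x ≡ g x) → Σ xs f ≡ Σ xs g
    Σ-cong-∈ []       f≡g = refl
    Σ-cong-∈ (x ∷ xs) f≡g = cong₂ _+_ (f≡g (here refl)) (Σ-cong-∈ xs (f≡g ∘ there))

    Σ-cong : ∀ (xs : List A) {f g : A → ℤ} → f ≗ g → Σ xs f ≡ Σ xs g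
    Σ-cong xs f≗g = Σ-cong-∈ xs (λ {x} _ → f≗g x)

    Σ-zero : ∀ (xs : List A) → Σ xs (λ _ → 0ℤ) ≡ 0ℤ
    Σ-zero []       = refl
    Σ-zero (x ∷ xs) = trans (ℤₚ.+-identityˡ _) (Σ-zero xs)

    Σ-+ : ∀ (xs : List A) (f g : A → ℤ) → Σ xs (λ x → f x + g x) ≡ Σ xs f + Σ xs g
    Σ-+ []       f g = refl
    Σ-+ (x ∷ xs) f g rewrite Σ-+ xs f g = +-interchange (f x) (g x) (Σ xs f) (Σ xs g)

    Σ-*ˡ : ∀ (xs : List A) (c : ℤ) (f : A → ℤ) → Σ xs (λ x → c * f x) ≡ c * Σ xs f
    Σ-*ˡ []       c f = sym (ℤₚ.*-zeroʳ c)
    Σ-*ˡ (x ∷ xs) c f rewrite Σ-*ˡ xs c f = sym (ℤₚ.*-distribˡ-+ c (f x) (Σ xs f))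

    Σ-*ʳ : ∀ (xs : List A) (f : A → ℤ) (c : ℤ) → Σ xs (λ x → f x * c) ≡ Σ xs f * c
    Σ-*ʳ []       f c = refl
    Σ-*ʳ (x ∷ xs) f c rewrite Σ-*ʳ xs f c = sym (ℤₚ.*-distribʳ-+ c (f x) (Σ xs f))

    Σ-neg : ∀ (xs : List A) (f : A → ℤ) → Σ xs (λ x → - f x) ≡ - Σ xs f
    Σ-neg []       f = refl
    Σ-neg (x ∷ xs) f rewrite Σ-neg xs f = sym (ℤₚ.neg-distrib-+ (f x) (Σ xs f))

    Σ-filter : ∀ {p} {P : A → Set p} (P? : ∀ x → Dec (P x)) (xs : List A) (g : A → ℤ) →
               Σ (filter P? xs) g ≡ Σ xs (λ x → 𝟙 (does (P? x)) * g x)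
    Σ-filter P? []       g = refl
    Σ-filter P? (x ∷ xs) g with P? x
    ... | yes _ = cong₂ _+_ (sym (ℤₚ.*-identityˡ (g x))) (Σ-filter P? xs g)
    ... | no  _ = trans (Σ-filter P? xs g) (sym (ℤₚ.+-identityˡ _))

    length-filter-Σ : ∀ {p} {P : A → Set p} (P? : ∀ x → Dec (P x)) (xs : List A) →
                      ℤ.+ length (filter P? xs) ≡ Σ xs (λ x → 𝟙 (does (P? x)))
    length-filter-Σ P? []       = refl
    length-filter-Σ P? (x ∷ xs) with P? x
    ... | yes _ = cong (1ℤ +_) (length-filter-Σ P? xs)
    ... | no  _ = trans (length-filter-Σ P? xs) (sym (ℤₚ.+-identityˡ _))

    sumℤ-concatMap : ∀ (xs : List A) (f : A → List ℤ) → sumℤ (concatMap f xs) ≡ Σ xs (sumℤ ∘ f)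
    sumℤ-concatMap []       f = refl
    sumℤ-concatMap (x ∷ xs) f = trans (sumℤ-++ (f x)) (cong (sumℤ (f x) +_) (sumℤ-concatMap xs f))
      where
      sumℤ-++ : ∀ us {vs} → sumℤ (us ++ vs) ≡ sumℤ us + sumℤ vs
      sumℤ-++ []       = sym (ℤₚ.+-identityˡ _)
      sumℤ-++ (u ∷ us) = trans (cong (u +_) (sumℤ-++ us)) (sym (ℤₚ.+-assoc u _ _))

  module _ {a b} {A : Set a} {B : Set b} where

    Σ-comm : ∀ (xs : List A) (ys : List B) (f : A → B → ℤ) →
             Σ xs (λ x → Σ ys (f x)) ≡ Σ ys (λ y → Σ xs (λ x → f x y))
    Σ-comm []       ys f = sym (Σ-zero ys)
    Σ-comm (x ∷ xs) ys f rewrite Σ-comm xs ys f = sym (Σ-+ ys (f x) (λ y → Σ xs (λ x → f x y)))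

    Σ-comm-*ˡ : ∀ (xs : List A) (ys : List B) (c : B → ℤ) (f : A → B → ℤ) →
                Σ xs (λ x → Σ ys (λ y → c y * f x y)) ≡ Σ ys (λ y → c y * Σ xs (λ x → f x y))
    Σ-comm-*ˡ xs ys c f = trans (Σ-comm xs ys _) (Σ-cong ys (λ y → Σ-*ˡ xs (c y) (λ x → f x y)))

    Σ-map : ∀ (xs : List A) (h : A → B) (g : B → ℤ) → Σ (map h xs) g ≡ Σ xs (g ∘ h)
    Σ-map []       h g = refl
    Σ-map (x ∷ xs) h g = cong (g (h x) +_) (Σ-map xs h g)

    Σ-concatMap : ∀ (xs : List A) (f : A → List B) (g : B → ℤ) → Σ (concatMap f xs) g ≡ Σ xs (λ x → Σ (f x) g)
    Σ-concatMap xs f g = begin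
      sumℤ (map g (concatMap f xs))    ≡⟨ cong sumℤ (map-concatMap g f xs) ⟩
      sumℤ (concatMap (map g ∘ f) xs)  ≡⟨ sumℤ-concatMap xs (map g ∘ f) ⟩
      Σ xs (λ x → Σ (f x) g)           ∎
      where open ≡-Reasoning

  Σ-allFin-suc : ∀ m (f : Fin (suc m) → ℤ) → Σ (allFin (suc m)) f ≡ f zero + Σ (allFin m) (f ∘ suc)
  Σ-allFin-suc m f = cong (λ xs → f zero + sumℤ xs) (trans (map-tabulate suc f) (sym (map-tabulate id (f ∘ suc))))

  Σ-allFin-supported : ∀ m (f : Fin m → ℤ) (k : Fin m) → (∀ i → i ≢ k → f i ≡ 0ℤ) → Σ (allFin m) f ≡ f k
  Σ-allFin-supported (suc m) f zero    f≡0 = begin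
    Σ (allFin (suc m)) f            ≡⟨ Σ-allFin-suc m f ⟩
    f zero + Σ (allFin m) (f ∘ suc) ≡⟨ cong (f zero +_) (Σ-cong (allFin m) (λ i → f≡0 (suc i) λ ())) ⟩
    f zero + Σ (allFin m) (λ _ → 0ℤ) ≡⟨ cong (f zero +_) (Σ-zero (allFin m)) ⟩
    f zero + 0ℤ                     ≡⟨ ℤₚ.+-identityʳ (f zero) ⟩
    f zero                          ∎
    where open ≡-Reasoning
  Σ-allFin-supported (suc m) f (suc k) f≡0 = begin
    Σ (allFin (suc m)) f            ≡⟨ Σ-allFin-suc m f ⟩
    f zero + Σ (allFin m) (f ∘ suc) ≡⟨ cong (_+ Σ (allFin m) (f ∘ suc)) (f≡0 zero λ ()) ⟩
    0ℤ + Σ (allFin m) (f ∘ suc)     ≡⟨ ℤₚ.+-identityˡ _ ⟩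
    Σ (allFin m) (f ∘ suc)          ≡⟨ Σ-allFin-supported m (f ∘ suc) k (λ i → f≡0 (suc i) ∘ (_∘ Finₚ.suc-injective)) ⟩
    f (suc k)                       ∎
    where open ≡-Reasoning

  module _ {a ℓ} {A : Set a} {_≈_ : Rel A ℓ} (_≈?_ : Decidable _≈_) where

    Enumerates : List A → Set a
    Enumerates xs = ∀ y → Σ xs (λ x → 𝟙 (does (x ≈? y))) ≡ 1ℤ

    Σ-pick : ∀ xs → Enumerates xs → ∀ {f : A → ℤ} → f Preserves _≈_ ⟶ _≡_ →
             ∀ y → Σ xs (λ x → 𝟙 (does (x ≈? y)) * f x) ≡ f y
    Σ-pick xs enum {f} f-resp y = begin
      Σ xs (λ x → 𝟙 (does (x ≈? y)) * f x)  ≡⟨ Σ-cong xs weight ⟩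
      Σ xs (λ x → 𝟙 (does (x ≈? y)) * f y)  ≡⟨ Σ-*ʳ xs _ (f y) ⟩
      Σ xs (λ x → 𝟙 (does (x ≈? y))) * f y  ≡⟨ cong (_* f y) (enum y) ⟩
      1ℤ * f y                              ≡⟨ ℤₚ.*-identityˡ (f y) ⟩
      f y                                   ∎
      where
      open ≡-Reasoning
      weight : ∀ x → 𝟙 (does (x ≈? y)) * f x ≡ 𝟙 (does (x ≈? y)) * f y
      weight x with x ≈? y
      ... | yes x≈y = cong (1ℤ *_) (f-resp x≈y)
      ... | no  _   = refl

    Σ-reindex : ∀ xs → Enumerates xs → ∀ {f : A → ℤ} → f Preserves _≈_ ⟶ _≡_ →
                (σ σ⁻¹ : A → A) → (∀ x y → (x ≈ σ y) ⇔ (y ≈ σ⁻¹ x)) →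
                Σ xs (f ∘ σ) ≡ Σ xs f
    Σ-reindex xs enum {f} f-resp σ σ⁻¹ σ-inverse = begin
      Σ xs (f ∘ σ)
        ≡⟨ Σ-cong xs (λ y → sym (Σ-pick xs enum f-resp (σ y))) ⟩
      Σ xs (λ y → Σ xs (λ x → 𝟙 (does (x ≈? σ y)) * f x))
        ≡⟨ Σ-comm xs xs _ ⟩
      Σ xs (λ x → Σ xs (λ y → 𝟙 (does (x ≈? σ y)) * f x))
        ≡⟨ Σ-cong xs (λ x → Σ-cong xs (λ y → cong (λ b → 𝟙 b * f x) (does-⇔ (σ-inverse x y) (x ≈? σ y) (y ≈? σ⁻¹ x)))) ⟩
      Σ xs (λ x → Σ xs (λ y → 𝟙 (does (y ≈? σ⁻¹ x)) * f x))
        ≡⟨ Σ-cong xs (λ x → Σ-*ʳ xs _ (f x)) ⟩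
      Σ xs (λ x → Σ xs (λ y → 𝟙 (does (y ≈? σ⁻¹ x))) * f x)
        ≡⟨ Σ-cong xs (λ x → cong (_* f x) (enum (σ⁻¹ x))) ⟩
      Σ xs (λ x → 1ℤ * f x)
        ≡⟨ Σ-cong xs (λ x → ℤₚ.*-identityˡ (f x)) ⟩
      Σ xs f ∎
      where open ≡-Reasoning

  allFin-enumerates : ∀ m → Enumerates _≟_ (allFin m)
  allFin-enumerates m y = trans (Σ-allFin-supported m _ y off) on
    where
    off : ∀ i → i ≢ y → 𝟙 (does (i ≟ y)) ≡ 0ℤ
    off i i≢y rewrite dec-false (i ≟ y) i≢y = refl
    on : 𝟙 (does (y ≟ y)) ≡ 1ℤ
    on rewrite dec-true (y ≟ y) refl = refl

  Σ-allFin-reindex : ∀ {m} (f : Fin m → ℤ) (σ σ⁻¹ : Fin m → Fin m) →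
                     (∀ i → σ⁻¹ (σ i) ≡ i) → (∀ i → σ (σ⁻¹ i) ≡ i) →
                     Σ (allFin m) (f ∘ σ) ≡ Σ (allFin m) f
  Σ-allFin-reindex {m} f σ σ⁻¹ σ⁻¹∘σ σ∘σ⁻¹ =
    Σ-reindex _≟_ (allFin m) (allFin-enumerates m) (cong f) σ σ⁻¹ (λ i j →
      mk⇔ (λ i≡σj → trans (sym (σ⁻¹∘σ j)) (cong σ⁻¹ (sym i≡σj)))
          (λ j≡σ⁻¹i → trans (sym (σ∘σ⁻¹ i)) (cong σ (sym j≡σ⁻¹i))))

  _≗?_ : ∀ {m k} → Decidable {A = Fin m → Fin k} _≗_
  f ≗? g = Finₚ.all? (λ x → f x ≟ g x)

  allFuns-enumerates : ∀ m k → Enumerates _≗?_ (allFuns m k)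
  allFuns-enumerates zero    k g = refl
  -- does (h ≗? g) computes to the test at zero ∧ the test on the tail, which drives the first step.
  allFuns-enumerates (suc m) k g = begin
    Σ (allFuns (suc m) k) (λ h → 𝟙 (does (h ≗? g)))
      ≡⟨ trans (Σ-concatMap (allFuns m k) _ _) (Σ-cong (allFuns m k) (λ f → Σ-map (allFin k) _ _)) ⟩
    Σ (allFuns m k) (λ f → Σ (allFin k) (λ i → 𝟙 (does (i ≟ g zero) ∧ does (f ≗? (g ∘ suc)))))
      ≡⟨ Σ-cong (allFuns m k) (λ f → Σ-cong (allFin k) (λ i → 𝟙-∧ (does (i ≟ g zero)) (does (f ≗? (g ∘ suc))))) ⟩
    Σ (allFuns m k) (λ f → Σ (allFin k) (λ i → 𝟙 (does (i ≟ g zero)) * 𝟙 (does (f ≗? (g ∘ suc)))))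
      ≡⟨ Σ-cong (allFuns m k) (λ f → trans (Σ-*ʳ (allFin k) _ _) (cong (_* 𝟙 (does (f ≗? (g ∘ suc)))) (allFin-enumerates k (g zero)))) ⟩
    Σ (allFuns m k) (λ f → 1ℤ * 𝟙 (does (f ≗? (g ∘ suc))))
      ≡⟨ Σ-cong (allFuns m k) (λ f → ℤₚ.*-identityˡ _) ⟩
    Σ (allFuns m k) (λ f → 𝟙 (does (f ≗? (g ∘ suc))))
      ≡⟨ allFuns-enumerates m k (g ∘ suc) ⟩
    1ℤ ∎
    where open ≡-Reasoning

open FiniteSums

injective⇒surjective : ∀ {m} {π : Fin m → Fin m} → Injective _≡_ _≡_ π → ∀ y → ∃ λ x → π x ≡ y
injective⇒surjective {suc m} {π} π-inj y with Finₚ.any? (λ x → π x ≟ y)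
... | yes hit = hit
... | no  miss = contradiction (Finₚ.injective⇒≤ punched-injective) ℕₚ.1+n≰n
  where
  punched : Fin (suc m) → Fin m
  punched x = punchOut {i = y} {j = π x} (λ y≡πx → miss (x , sym y≡πx))
  punched-injective : Injective _≡_ _≡_ punched
  punched-injective {x} {x′} eq =
    π-inj (Finₚ.punchOut-injective {i = y} (λ y≡πx → miss (x , sym y≡πx)) (λ y≡πx′ → miss (x′ , sym y≡πx′)) eq)

Σ-allFin-∘-injective : ∀ {m} (f : Fin m → ℤ) {π : Fin m → Fin m} → Injective _≡_ _≡_ π →
                       Σ (allFin m) (f ∘ π) ≡ Σ (allFin m) f
Σ-allFin-∘-injective f {π} π-inj = Σ-allFin-reindex f π π⁻¹ (λ i → π-inj (proj₂ (surj (π i)))) (proj₂ ∘ surj)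
  where
  surj = injective⇒surjective π-inj
  π⁻¹ = proj₁ ∘ surj

module Signs where

  open import Data.Integer using (_+_)
  open import Data.Fin using (_≤_; _<_; _<?_)

  module _ {m : ℕ} where

    transpose-matchˡ : ∀ (i j : Fin m) → transpose i j i ≡ j
    transpose-matchˡ i j rewrite dec-true (i ≟ i) refl = refl

    transpose-matchʳ : ∀ (i j : Fin m) → transpose i j j ≡ i
    transpose-matchʳ i j with j ≟ i
    ... | yes j≡i = j≡i
    ... | no  _   rewrite dec-true (j ≟ j) refl = refl

    transpose-other : ∀ {i j x : Fin m} → x ≢ i → x ≢ j → transpose i j x ≡ x
    transpose-other {i} {j} {x} x≢i x≢j rewrite dec-false (x ≟ i) x≢i | dec-false (x ≟ j) x≢j = refl

    transpose-comm : ∀ (i j x : Fin m) → transpose i j x ≡ transpose j i x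
    transpose-comm i j x = by-cases (x ≟ i) (x ≟ j)
      where
      by-cases : Dec (x ≡ i) → Dec (x ≡ j) → transpose i j x ≡ transpose j i x
      by-cases (yes refl) _          = trans (transpose-matchˡ x j) (sym (transpose-matchʳ j x))
      by-cases (no _)     (yes refl) = trans (transpose-matchʳ i x) (sym (transpose-matchˡ x i))
      by-cases (no x≢i)   (no x≢j)   = trans (transpose-other x≢i x≢j) (sym (transpose-other x≢j x≢i))

    transpose-involutive : ∀ (i j x : Fin m) → transpose i j (transpose i j x) ≡ x
    transpose-involutive i j x = trans (cong (transpose i j) (transpose-comm i j x)) (transpose-inverse i j)

    transpose-conjugate : ∀ (s : Fin m → Fin m) → (∀ x → s (s x) ≡ x) →
                          ∀ i j x → s (transpose i j (s x)) ≡ transpose (s i) (s j) x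
    transpose-conjugate s s-inv i j x = by-cases (x ≟ s i) (x ≟ s j)
      where
      open ≡-Reasoning
      s-flip : ∀ {y} → s x ≡ y → x ≡ s y
      s-flip refl = sym (s-inv x)
      by-cases : Dec (x ≡ s i) → Dec (x ≡ s j) → s (transpose i j (s x)) ≡ transpose (s i) (s j) x
      by-cases (yes refl) _ = begin
        s (transpose i j (s (s i))) ≡⟨ cong (s ∘ transpose i j) (s-inv i) ⟩
        s (transpose i j i)         ≡⟨ cong s (transpose-matchˡ i j) ⟩
        s j                         ≡⟨ sym (transpose-matchˡ (s i) (s j)) ⟩
        transpose (s i) (s j) (s i) ∎
      by-cases (no _) (yes refl) = begin
        s (transpose i j (s (s j))) ≡⟨ cong (s ∘ transpose i j) (s-inv j) ⟩
        s (transpose i j j)         ≡⟨ cong s (transpose-matchʳ i j) ⟩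
        s i                         ≡⟨ sym (transpose-matchʳ (s i) (s j)) ⟩
        transpose (s i) (s j) (s j) ∎
      by-cases (no x≢si) (no x≢sj) = begin
        s (transpose i j (s x)) ≡⟨ cong s (transpose-other (x≢si ∘ s-flip) (x≢sj ∘ s-flip)) ⟩
        s (s x)                 ≡⟨ s-inv x ⟩
        x                       ≡⟨ sym (transpose-other x≢si x≢sj) ⟩
        transpose (s i) (s j) x ∎

  ΣΣ : ∀ m → (Fin m → Fin m → ℤ) → ℤ
  ΣΣ m f = Σ (allFin m) (λ i → Σ (allFin m) (f i))

  ΣΣ-cong : ∀ {m} {f g : Fin m → Fin m → ℤ} → (∀ i j → f i j ≡ g i j) → ΣΣ m f ≡ ΣΣ m g
  ΣΣ-cong {m} f≡g = Σ-cong (allFin m) (λ i → Σ-cong (allFin m) (f≡g i))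

  ΣΣ-+ : ∀ {m} (f g : Fin m → Fin m → ℤ) → ΣΣ m (λ i j → f i j + g i j) ≡ ΣΣ m f + ΣΣ m g
  ΣΣ-+ {m} f g = trans (Σ-cong (allFin m) (λ i → Σ-+ (allFin m) (f i) (g i))) (Σ-+ (allFin m) _ _)

  inversions-ΣΣ : ∀ {m} (π : Fin m → Fin m) →
                  ℤ.+ inversions π ≡ ΣΣ m (λ i j → 𝟙 (does (i <? j)) * 𝟙 (does (π j <? π i)))
  inversions-ΣΣ {m} π = begin
    ℤ.+ length (filter inverted? (filter ordered? pairs))      ≡⟨ length-filter-Σ inverted? (filter ordered? pairs) ⟩
    Σ (filter ordered? pairs) (𝟙 ∘ does ∘ inverted?)           ≡⟨ Σ-filter ordered? pairs (𝟙 ∘ does ∘ inverted?) ⟩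
    Σ pairs (λ ij → 𝟙 (does (ordered? ij)) * 𝟙 (does (inverted? ij)))
      ≡⟨ Σ-concatMap (allFin m) (λ i → map (i ,_) (allFin m)) _ ⟩
    Σ (allFin m) (λ i → Σ (map (i ,_) (allFin m)) (λ ij → 𝟙 (does (ordered? ij)) * 𝟙 (does (inverted? ij))))
      ≡⟨ Σ-cong (allFin m) (λ i → Σ-map (allFin m) (i ,_) _) ⟩
    ΣΣ m (λ i j → 𝟙 (does (i <? j)) * 𝟙 (does (π j <? π i)))  ∎
    where
    open ≡-Reasoning
    pairs : List (Fin m × Fin m)
    pairs = concatMap (λ i → map (i ,_) (allFin m)) (allFin m)
    ordered? inverted? : ∀ (ij : Fin m × Fin m) → _
    ordered?  (i , j) = i <? j
    inverted? (i , j) = π j <? π i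

  sgn-cong : ∀ {m} {f g : Fin m → Fin m} → f ≗ g → sgn f ≡ sgn g
  sgn-cong {m} {f} {g} f≗g = cong (-1ℤ ℤ.^_) (ℤₚ.+-injective (begin
    ℤ.+ inversions f
      ≡⟨ inversions-ΣΣ f ⟩
    ΣΣ m (λ i j → 𝟙 (does (i <? j)) * 𝟙 (does (f j <? f i)))
      ≡⟨ ΣΣ-cong (λ i j → cong₂ (λ x y → 𝟙 (does (i <? j)) * 𝟙 (does (x <? y))) (f≗g j) (f≗g i)) ⟩
    ΣΣ m (λ i j → 𝟙 (does (i <? j)) * 𝟙 (does (g j <? g i)))
      ≡⟨ inversions-ΣΣ g ⟨
    ℤ.+ inversions g ∎))
    where open ≡-Reasoning

  ΣΣ-pick : ∀ {m} (k l : Fin m) (w : Fin m → Fin m → ℤ) →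
            ΣΣ m (λ i j → 𝟙 (does (i ≟ k) ∧ does (j ≟ l)) * w i j) ≡ w k l
  ΣΣ-pick {m} k l w = begin
    ΣΣ m (λ i j → 𝟙 (does (i ≟ k) ∧ does (j ≟ l)) * w i j)
      ≡⟨ ΣΣ-cong (λ i j → split (does (i ≟ k)) (does (j ≟ l)) (w i j)) ⟩
    ΣΣ m (λ i j → 𝟙 (does (i ≟ k)) * (𝟙 (does (j ≟ l)) * w i j))
      ≡⟨ Σ-cong (allFin m) (λ i → Σ-*ˡ (allFin m) (𝟙 (does (i ≟ k))) _) ⟩
    Σ (allFin m) (λ i → 𝟙 (does (i ≟ k)) * Σ (allFin m) (λ j → 𝟙 (does (j ≟ l)) * w i j))
      ≡⟨ Σ-pick _≟_ (allFin m) (allFin-enumerates m) (λ { refl → refl }) k ⟩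
    Σ (allFin m) (λ j → 𝟙 (does (j ≟ l)) * w k j)
      ≡⟨ Σ-pick _≟_ (allFin m) (allFin-enumerates m) (cong (w k)) l ⟩
    w k l ∎
    where
    open ≡-Reasoning
    split : ∀ a b x → 𝟙 (a ∧ b) * x ≡ 𝟙 a * (𝟙 b * x)
    split true  b x = sym (ℤₚ.*-identityˡ (𝟙 b * x))
    split false b x = refl

  ΣΣ-reindex-involution : ∀ {m} (s : Fin m → Fin m) → (∀ x → s (s x) ≡ x) →
                          (f : Fin m → Fin m → ℤ) → ΣΣ m (λ i j → f (s i) (s j)) ≡ ΣΣ m f
  ΣΣ-reindex-involution {m} s s-inv f =
    trans (Σ-cong (allFin m) (λ i → Σ-allFin-reindex (f (s i)) s s s-inv s-inv))
          (Σ-allFin-reindex (λ i → Σ (allFin m) (f i)) s s s-inv s-inv)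

  sgn-suc : ∀ {m} {ρ π : Fin m → Fin m} → inversions ρ ≡ suc (inversions π) → sgn ρ ≡ - sgn π
  sgn-suc {π = π} eq = trans (cong (-1ℤ ℤ.^_) eq) (ℤₚ.-1*i≡-i (sgn π))

  module AdjacentTransposition {m} (a : Fin (suc m)) where

    N : ℕ
    N = suc (suc m)

    k k' : Fin N
    k  = inject₁ a
    k' = suc a

    s : Fin N → Fin N
    s = transpose k k'

    s-involutive : ∀ x → s (s x) ≡ x
    s-involutive = transpose-involutive k k'

    k<k' : k < k'
    k<k' = Finₚ.≤̄⇒inject₁< Finₚ.≤-refl

    k≢k' : k ≢ k'
    k≢k' = Finₚ.<⇒≢ k<k'

    <k'⇒≤k : ∀ {x : Fin N} → x < k' → x ≤ k
    <k'⇒≤k {x} x<k' = subst (toℕ x ℕ.≤_) (sym (Finₚ.toℕ-inject₁ a)) (ℕ.s≤s⁻¹ x<k')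

    k<⇒k'≤ : ∀ {y : Fin N} → k < y → k' ≤ y
    k<⇒k'≤ {y} k<y = subst (λ n → suc n ℕ.≤ toℕ y) (Finₚ.toℕ-inject₁ a) k<y

    <-s : ∀ {x y} → x < y → ¬ (x ≡ k × y ≡ k') → s x < s y
    <-s {x} {y} x<y not-kk' = by-cases (x ≟ k) (x ≟ k') (y ≟ k) (y ≟ k')
      where
      by-cases : Dec (x ≡ k) → Dec (x ≡ k') → Dec (y ≡ k) → Dec (y ≡ k') → s x < s y
      by-cases (yes refl) _ _ (yes refl) = contradiction (refl , refl) not-kk'
      by-cases (yes refl) _ (yes refl) _ = contradiction x<y (Finₚ.<-irrefl refl)
      by-cases (yes refl) _ (no y≢k) (no y≢k') =
        subst₂ _<_ (sym (transpose-matchˡ k k')) (sym (transpose-other y≢k y≢k'))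
               (Finₚ.≤∧≢⇒< (k<⇒k'≤ x<y) (y≢k' ∘ sym))
      by-cases (no _) (yes refl) _ _ =
        subst₂ _<_ (sym (transpose-matchʳ k k')) (sym (transpose-other (Finₚ.<⇒≢ k<y ∘ sym) (Finₚ.<⇒≢ x<y ∘ sym))) k<y
        where
        k<y : k < y
        k<y = Finₚ.<-trans k<k' x<y
      by-cases (no x≢k) (no x≢k') (yes refl) _ =
        subst₂ _<_ (sym (transpose-other x≢k x≢k')) (sym (transpose-matchˡ k k')) (Finₚ.<-trans x<y k<k')
      by-cases (no x≢k) (no x≢k') (no _) (yes refl) =
        subst₂ _<_ (sym (transpose-other x≢k x≢k')) (sym (transpose-matchʳ k k')) (Finₚ.≤∧≢⇒< (<k'⇒≤k x<y) x≢k)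
      by-cases (no x≢k) (no x≢k') (no y≢k) (no y≢k') =
        subst₂ _<_ (sym (transpose-other x≢k x≢k')) (sym (transpose-other y≢k y≢k')) x<y

    does-<-s : ∀ i j → ¬ (i ≡ k × j ≡ k') → ¬ (i ≡ k' × j ≡ k) → does (s i <? s j) ≡ does (i <? j)
    does-<-s i j not-kk' not-k'k = does-⇔ (mk⇔ backward (λ i<j → <-s i<j not-kk')) (s i <? s j) (i <? j)
      where
      s-flip : ∀ {x y : Fin N} → s x ≡ y → x ≡ s y
      s-flip {x} refl = sym (s-involutive x)
      backward : s i < s j → i < j
      backward si<sj = subst₂ _<_ (s-involutive i) (s-involutive j)
        (<-s si<sj (λ (si≡k , sj≡k') → not-k'k (trans (s-flip si≡k) (transpose-matchˡ k k') ,
                                                 trans (s-flip sj≡k') (transpose-matchʳ k k'))))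

    -- Swapping the adjacent positions k < k' preserves the order of every pair except {k, k'}.
    𝟙-<-s : ∀ i j → 𝟙 (does (s i <? s j)) + 𝟙 (does (i ≟ k) ∧ does (j ≟ k')) ≡
                    𝟙 (does (i <? j))     + 𝟙 (does (i ≟ k') ∧ does (j ≟ k))
    𝟙-<-s i j = by-cases (i ≟ k) (j ≟ k') (i ≟ k') (j ≟ k)
      where
      unchanged : ¬ (i ≡ k × j ≡ k') → ¬ (i ≡ k' × j ≡ k) → 𝟙 (does (s i <? s j)) + 0ℤ ≡ 𝟙 (does (i <? j)) + 0ℤ
      unchanged h₁ h₂ = cong (λ b → 𝟙 b + 0ℤ) (does-<-s i j h₁ h₂)
      by-cases : (d₁ : Dec (i ≡ k)) (d₂ : Dec (j ≡ k')) (d₃ : Dec (i ≡ k')) (d₄ : Dec (j ≡ k)) →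
                 𝟙 (does (s i <? s j)) + 𝟙 (does d₁ ∧ does d₂) ≡ 𝟙 (does (i <? j)) + 𝟙 (does d₃ ∧ does d₄)
      by-cases (no _) _ (yes refl) (yes refl)
        rewrite transpose-matchˡ k k' | transpose-matchʳ k k'
              | dec-true (k <? k') k<k' | dec-false (k' <? k) (Finₚ.<-asym k<k') = refl
      by-cases (yes refl) (yes refl) (no _) _
        rewrite transpose-matchˡ k k' | transpose-matchʳ k k'
              | dec-true (k <? k') k<k' | dec-false (k' <? k) (Finₚ.<-asym k<k') = refl
      by-cases (yes refl) (yes refl) (yes i≡k') _ = contradiction i≡k' k≢k'
      by-cases (yes refl) (no j≢k') (no i≢k') _ = unchanged (j≢k' ∘ proj₂) (i≢k' ∘ proj₁)
      by-cases (yes refl) (no _) (yes i≡k') _ = contradiction i≡k' k≢k'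
      by-cases (no i≢k) _ (no i≢k') _ = unchanged (i≢k ∘ proj₁) (i≢k' ∘ proj₁)
      by-cases (no i≢k) _ (yes _) (no j≢k) = unchanged (i≢k ∘ proj₁) (j≢k ∘ proj₂)

    inversions-∘-s : ∀ (π : Fin N → Fin N) →
                     ℤ.+ inversions (π ∘ s) + 𝟙 (does (π k' <? π k)) ≡ ℤ.+ inversions π + 𝟙 (does (π k <? π k'))
    inversions-∘-s π = begin
      ℤ.+ inversions (π ∘ s) + w k k'
        ≡⟨ cong₂ _+_ (trans (inversions-ΣΣ (π ∘ s)) reindexed) (sym (ΣΣ-pick k k' w)) ⟩
      ΣΣ N (λ i j → 𝟙 (does (s i <? s j)) * w i j) + ΣΣ N (λ i j → 𝟙 (does (i ≟ k) ∧ does (j ≟ k')) * w i j)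
        ≡⟨ distrib (λ i j → 𝟙 (does (s i <? s j))) (λ i j → 𝟙 (does (i ≟ k) ∧ does (j ≟ k'))) ⟨
      ΣΣ N (λ i j → (𝟙 (does (s i <? s j)) + 𝟙 (does (i ≟ k) ∧ does (j ≟ k'))) * w i j)
        ≡⟨ ΣΣ-cong (λ i j → cong (_* w i j) (𝟙-<-s i j)) ⟩
      ΣΣ N (λ i j → (𝟙 (does (i <? j)) + 𝟙 (does (i ≟ k') ∧ does (j ≟ k))) * w i j)
        ≡⟨ distrib (λ i j → 𝟙 (does (i <? j))) (λ i j → 𝟙 (does (i ≟ k') ∧ does (j ≟ k))) ⟩
      ΣΣ N (λ i j → 𝟙 (does (i <? j)) * w i j) + ΣΣ N (λ i j → 𝟙 (does (i ≟ k') ∧ does (j ≟ k)) * w i j)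
        ≡⟨ cong₂ _+_ (sym (inversions-ΣΣ π)) (ΣΣ-pick k' k w) ⟩
      ℤ.+ inversions π + w k' k ∎
      where
      open ≡-Reasoning
      w : Fin N → Fin N → ℤ
      w i j = 𝟙 (does (π j <? π i))
      reindexed : ΣΣ N (λ i j → 𝟙 (does (i <? j)) * w (s i) (s j)) ≡ ΣΣ N (λ i j → 𝟙 (does (s i <? s j)) * w i j)
      reindexed =
        trans (ΣΣ-cong (λ i j → cong₂ (λ x y → 𝟙 (does (x <? y)) * w (s i) (s j)) (sym (s-involutive i)) (sym (s-involutive j))))
              (ΣΣ-reindex-involution s s-involutive (λ i j → 𝟙 (does (s i <? s j)) * w i j))
      distrib : ∀ (f g : Fin N → Fin N → ℤ) →
                ΣΣ N (λ i j → (f i j + g i j) * w i j) ≡ ΣΣ N (λ i j → f i j * w i j) + ΣΣ N (λ i j → g i j * w i j)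
      distrib f g = trans (ΣΣ-cong (λ i j → ℤₚ.*-distribʳ-+ (w i j) (f i j) (g i j)))
                          (ΣΣ-+ (λ i j → f i j * w i j) (λ i j → g i j * w i j))

    sgn-∘-s : ∀ {π : Fin N → Fin N} → Injective _≡_ _≡_ π → sgn (π ∘ s) ≡ - sgn π
    sgn-∘-s {π} π-inj with Finₚ.<-cmp (π k) (π k')
    ... | tri≈ _ πk≡πk' _ = contradiction (π-inj πk≡πk') k≢k'
    ... | tri< πk<πk' _ πk'≮πk = sgn-suc {ρ = π ∘ s} {π} (ℕ-count (inversions-∘-s π))
      where
      ℕ-count : ℤ.+ inversions (π ∘ s) + 𝟙 (does (π k' <? π k)) ≡ ℤ.+ inversions π + 𝟙 (does (π k <? π k')) →
                inversions (π ∘ s) ≡ suc (inversions π)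
      ℕ-count eq rewrite dec-false (π k' <? π k) πk'≮πk | dec-true (π k <? π k') πk<πk' =
        trans (sym (ℕₚ.+-identityʳ _)) (trans (ℤₚ.+-injective eq) (ℕₚ.+-comm (inversions π) 1))
    ... | tri> πk≮πk' _ πk'<πk =
      sym (trans (cong -_ (sgn-suc {ρ = π} {π ∘ s} (ℕ-count (inversions-∘-s π)))) (ℤₚ.neg-involutive _))
      where
      ℕ-count : ℤ.+ inversions (π ∘ s) + 𝟙 (does (π k' <? π k)) ≡ ℤ.+ inversions π + 𝟙 (does (π k <? π k')) →
                inversions π ≡ suc (inversions (π ∘ s))
      ℕ-count eq rewrite dec-true (π k' <? π k) πk'<πk | dec-false (π k <? π k') πk≮πk' =
        trans (sym (ℕₚ.+-identityʳ _)) (trans (sym (ℤₚ.+-injective eq)) (ℕₚ.+-comm (inversions (π ∘ s)) 1))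

  transpose-injective : ∀ {m} (i j : Fin m) → Injective _≡_ _≡_ (transpose i j)
  transpose-injective i j {x} {y} eq =
    trans (sym (transpose-involutive i j x)) (trans (cong (transpose i j) eq) (transpose-involutive i j y))

  ∘-transpose-injective : ∀ {m} {π : Fin m → Fin m} → Injective _≡_ _≡_ π →
                          ∀ i j → Injective _≡_ _≡_ (π ∘ transpose i j)
  ∘-transpose-injective π-inj i j = transpose-injective i j ∘ π-inj

  sgn-∘-transpose-at-distance : ∀ {m} d {i : Fin (suc (suc m))} (b : Fin (suc m)) → toℕ b ≡ toℕ i ℕ.+ d →
                      ∀ {π} → Injective _≡_ _≡_ π → sgn (π ∘ transpose i (suc b)) ≡ - sgn π
  sgn-∘-transpose-at-distance zero {i} b b≡i π-inj
    rewrite Finₚ.toℕ-injective {i = i} {inject₁ b}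
              (trans (sym (ℕₚ.+-identityʳ _)) (trans (sym b≡i) (sym (Finₚ.toℕ-inject₁ b))))
    = sgn-∘-s π-inj
    where open AdjacentTransposition b
  sgn-∘-transpose-at-distance (suc d) {i} zero 0≡i+1+d π-inj =
    contradiction (trans 0≡i+1+d (ℕₚ.+-suc (toℕ i) d)) ℕₚ.0≢1+n
  sgn-∘-transpose-at-distance (suc d) {i} (suc c) c+1≡i+1+d {π} π-inj = begin
    sgn (π ∘ transpose i k')          ≡⟨ sgn-cong (λ x → cong π (sym (conjugated x))) ⟩
    sgn (π ∘ s ∘ transpose i k ∘ s)   ≡⟨ sgn-∘-s (∘-transpose-injective πs-inj i k) ⟩
    - sgn (π ∘ s ∘ transpose i k)     ≡⟨ cong -_ (sgn-∘-transpose-at-distance d (inject₁ c) c≡i+d πs-inj) ⟩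
    - - sgn (π ∘ s)                   ≡⟨ ℤₚ.neg-involutive _ ⟩
    sgn (π ∘ s)                       ≡⟨ sgn-∘-s π-inj ⟩
    - sgn π                           ∎
    where
    open ≡-Reasoning
    open AdjacentTransposition (suc c)
    πs-inj : Injective _≡_ _≡_ (π ∘ s)
    πs-inj = ∘-transpose-injective π-inj k k'
    c≡i+d : toℕ (inject₁ c) ≡ toℕ i ℕ.+ d
    c≡i+d = trans (Finₚ.toℕ-inject₁ c) (ℕₚ.suc-injective (trans c+1≡i+1+d (ℕₚ.+-suc (toℕ i) d)))
    i≢k : i ≢ k
    i≢k i≡k = ℕₚ.m≢1+m+n (toℕ i)
      (trans (cong toℕ i≡k) (trans (Finₚ.toℕ-inject₁ (suc c)) (trans c+1≡i+1+d (ℕₚ.+-suc (toℕ i) d))))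
    i≢k' : i ≢ k'
    i≢k' i≡k' = ℕₚ.m≢1+m+n (toℕ i) (trans (cong toℕ i≡k') (cong suc c+1≡i+1+d))
    conjugated : ∀ x → s (transpose i k (s x)) ≡ transpose i k' x
    conjugated x = trans (transpose-conjugate s s-involutive i k x)
                         (cong₂ (λ u v → transpose u v x) (transpose-other i≢k i≢k') (transpose-matchˡ k k'))

  sgn-∘-transpose-< : ∀ {m} {π : Fin m → Fin m} → Injective _≡_ _≡_ π → ∀ {i j : Fin m} → i < j →
                      sgn (π ∘ transpose i j) ≡ - sgn π
  sgn-∘-transpose-< {suc zero}    _     {j = suc ()}
  sgn-∘-transpose-< {suc (suc m)} π-inj {i} {suc b} i<j =
    sgn-∘-transpose-at-distance (toℕ b ℕ.∸ toℕ i) b (sym (ℕₚ.m+[n∸m]≡n (ℕ.s≤s⁻¹ i<j))) π-inj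

  sgn-∘-transpose : ∀ {m} {π : Fin m → Fin m} → Injective _≡_ _≡_ π → ∀ {i j} → i ≢ j →
                    sgn (π ∘ transpose i j) ≡ - sgn π
  sgn-∘-transpose {π = π} π-inj {i} {j} i≢j with Finₚ.<-cmp i j
  ... | tri≈ _ i≡j _ = contradiction i≡j i≢j
  ... | tri< i<j _ _ = sgn-∘-transpose-< π-inj i<j
  ... | tri> _ _ j<i = trans (sgn-cong (λ x → cong π (transpose-comm i j x))) (sgn-∘-transpose-< π-inj j<i)

  ∈-perms⇒injective : ∀ {m} {π : Fin m → Fin m} → π ∈ perms m → Injective _≡_ _≡_ π
  ∈-perms⇒injective {m} π∈perms {i} {j} = proj₂ (∈-filter⁻ injective? {xs = allFuns m m} π∈perms) i j

  i≡-i⇒i≡0 : ∀ i → i ≡ - i → i ≡ 0ℤ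
  i≡-i⇒i≡0 (ℤ.+ zero)  _  = refl
  i≡-i⇒i≡0 ℤ.+[1+ n ]  ()
  i≡-i⇒i≡0 ℤ.-[1+ n ]  ()

  Σ-perms-sgn-cancel : ∀ {m} (h : (Fin m → Fin m) → ℤ) → h Preserves _≗_ ⟶ _≡_ →
                       ∀ {i j : Fin m} → i ≢ j → (∀ π → h (π ∘ transpose i j) ≡ h π) →
                       Σ (perms m) (λ π → sgn π * h π) ≡ 0ℤ
  -- perms m is a filtered list, so the reindexing π ↦ π ∘ τ is done over allFuns m m.
  Σ-perms-sgn-cancel {m} h h-resp {i} {j} i≢j h-invariant =
    trans (Σ-filter injective? (allFuns m m) _) (i≡-i⇒i≡0 _ (begin
      Σ (allFuns m m) G
        ≡⟨ Σ-reindex _≗?_ (allFuns m m) (allFuns-enumerates m m) G-resp (_∘ τ) (_∘ τ) τ-inverse ⟨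
      Σ (allFuns m m) (λ f → G (f ∘ τ)) ≡⟨ Σ-cong (allFuns m m) G-alternates ⟩
      Σ (allFuns m m) (λ f → - G f)     ≡⟨ Σ-neg (allFuns m m) G ⟩
      - Σ (allFuns m m) G               ∎))
    where
    open ≡-Reasoning
    τ : Fin m → Fin m
    τ = transpose i j
    Injective′ : (Fin m → Fin m) → Set
    Injective′ f = ∀ x y → f x ≡ f y → x ≡ y
    G : (Fin m → Fin m) → ℤ
    G f = 𝟙 (does (injective? f)) * (sgn f * h f)
    injective-cong : ∀ {f g : Fin m → Fin m} → f ≗ g → Injective′ f → Injective′ g
    injective-cong f≗g f-inj x y gx≡gy = f-inj x y (trans (f≗g x) (trans gx≡gy (sym (f≗g y))))
    G-resp : G Preserves _≗_ ⟶ _≡_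
    G-resp {f} {g} f≗g = cong₂ (λ b z → 𝟙 b * z)
      (does-⇔ (mk⇔ (injective-cong f≗g) (injective-cong (sym ∘ f≗g))) (injective? f) (injective? g))
      (cong₂ _*_ (sgn-cong f≗g) (h-resp f≗g))
    τ-inverse : ∀ f g → (f ≗ g ∘ τ) ⇔ (g ≗ f ∘ τ)
    τ-inverse f g = mk⇔ (λ f≗gτ x → trans (sym (cong g (transpose-involutive i j x))) (sym (f≗gτ (τ x))))
                        (λ g≗fτ x → trans (sym (cong f (transpose-involutive i j x))) (sym (g≗fτ (τ x))))
    injective-∘τ : ∀ f → Injective′ (f ∘ τ) ⇔ Injective′ f
    injective-∘τ f = mk⇔
      (λ fτ-inj x y fx≡fy → transpose-injective i j (fτ-inj (τ x) (τ y)
        (trans (cong f (transpose-involutive i j x)) (trans fx≡fy (sym (cong f (transpose-involutive i j y)))))))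
      (λ f-inj x y fτx≡fτy → transpose-injective i j (f-inj (τ x) (τ y) fτx≡fτy))
    G-alternates : ∀ f → G (f ∘ τ) ≡ - G f
    G-alternates f =
      trans (cong₂ (λ b z → 𝟙 b * (sgn (f ∘ τ) * z)) (does-⇔ (injective-∘τ f) (injective? (f ∘ τ)) (injective? f)) (h-invariant f))
            (by-cases (injective? f))
      where
      by-cases : (d : Dec (Injective′ f)) → 𝟙 (does d) * (sgn (f ∘ τ) * h f) ≡ - (𝟙 (does d) * (sgn f * h f))
      by-cases (no _)      = refl
      by-cases (yes f-inj) = begin
        1ℤ * (sgn (f ∘ τ) * h f) ≡⟨ ℤₚ.*-identityˡ _ ⟩
        sgn (f ∘ τ) * h f        ≡⟨ cong (_* h f) (sgn-∘-transpose (λ {x} {y} → f-inj x y) i≢j) ⟩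
        - sgn f * h f            ≡⟨ ℤₚ.neg-distribˡ-* (sgn f) (h f) ⟨
        - (sgn f * h f)          ≡⟨ cong -_ (ℤₚ.*-identityˡ _) ⟨
        - (1ℤ * (sgn f * h f))   ∎

open Signs

open import Data.Nat using (_≤_; _<_; _+_)
open import Data.Integer using (_-_)

module _ {n p q : ℕ} where

  exchangeAt : Fin q → Filling n p q → Fin p → Filling n p q
  exchangeAt t G l = filling (λ r → if does (r ≟ l) then col₂ G t else col₁ G r)
                             (λ r → if does (r ≟ t) then col₁ G l else col₂ G r)

  _≐_ : Filling n p q → Filling n p q → Set
  G ≐ H = col₁ G ≗ col₁ H × col₂ G ≗ col₂ H

  sameRows : Filling n p q → Filling n p q → ℤ
  sameRows G S = 𝟙 (does (sameRowContent? G S))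

  sameRows-cong : ∀ {G H : Filling n p q} → SameRowContent G H → ∀ S → sameRows G S ≡ sameRows H S
  sameRows-cong G∼H S = cong 𝟙 (does-⇔ (mk⇔ (λ G∼S r v → trans (sym (G∼H r v)) (G∼S r v))
                                           (λ H∼S r v → trans (G∼H r v) (H∼S r v)))
                                      (sameRowContent? _ S) (sameRowContent? _ S))

  rowContent-cong : ∀ {G H : Filling n p q} r → col₁ G r ≡ col₁ H r →
                    (∀ (h : toℕ r < q) → col₂ G (fromℕ< h) ≡ col₂ H (fromℕ< h)) →
                    rowContent G r ≗ rowContent H r
  rowContent-cong r eq₁ eq₂ v with toℕ r ℕ.<? q
  ... | yes h = cong₂ (λ x y → occ v (x ∷ y ∷ [])) eq₁ (eq₂ h)
  ... | no  _ = cong (λ x → occ v (x ∷ [])) eq₁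

  rowContent-swap : ∀ {G H : Filling n p q} r (h : toℕ r < q) →
                    col₁ G r ≡ col₂ H (fromℕ< h) → col₂ G (fromℕ< h) ≡ col₁ H r → rowContent G r ≗ rowContent H r
  rowContent-swap {G} {H} r h eq₁ eq₂ v with toℕ r ℕ.<? q
  ... | yes _ = trans (cong₂ (λ x y → occ v (x ∷ y ∷ [])) eq₁ eq₂)
                      (↭-length (filter-↭ (_≟ v) (↭-swap (col₂ H (fromℕ< h)) (col₁ H r) ↭-refl)))
  ... | no ¬h = contradiction h ¬h

  ≐⇒sameRowContent : ∀ {G H : Filling n p q} → G ≐ H → SameRowContent G H
  ≐⇒sameRowContent (eq₁ , eq₂) r = rowContent-cong r (eq₁ r) (λ h → eq₂ (fromℕ< h))

  ≐-trans : ∀ {F G H : Filling n p q} → F ≐ G → G ≐ H → F ≐ H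
  ≐-trans (f₁ , f₂) (g₁ , g₂) = (λ r → trans (f₁ r) (g₁ r)) , (λ r → trans (f₂ r) (g₂ r))

  exchangeAt-cong : ∀ {G H : Filling n p q} → G ≐ H → ∀ t i → exchangeAt t G i ≐ exchangeAt t H i
  exchangeAt-cong {G} {H} (eq₁ , eq₂) t i =
    (λ r → cong₂ (λ x y → if does (r ≟ i) then x else y) (eq₂ t) (eq₁ r)) ,
    (λ r → cong₂ (λ x y → if does (r ≟ t) then x else y) (eq₁ i) (eq₂ r))

  act-cong : ∀ {G H : Filling n p q} → G ≐ H → ∀ π₁ π₂ → act G π₁ π₂ ≐ act H π₁ π₂
  act-cong (eq₁ , eq₂) π₁ π₂ = eq₁ ∘ π₁ , eq₂ ∘ π₂

  sameRows-≐ : ∀ {G H : Filling n p q} → G ≐ H → ∀ S → sameRows G S ≡ sameRows H S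
  sameRows-≐ G≐H = sameRows-cong (≐⇒sameRowContent G≐H)

  module _ (t : Fin q) (G : Filling n p q) (l : Fin p) where

    col₁-exchangeAt-≡ : col₁ (exchangeAt t G l) l ≡ col₂ G t
    col₁-exchangeAt-≡ rewrite dec-true (l ≟ l) refl = refl

    col₁-exchangeAt-≢ : ∀ {r} → r ≢ l → col₁ (exchangeAt t G l) r ≡ col₁ G r
    col₁-exchangeAt-≢ {r} r≢l rewrite dec-false (r ≟ l) r≢l = refl

    col₂-exchangeAt-≡ : col₂ (exchangeAt t G l) t ≡ col₁ G l
    col₂-exchangeAt-≡ rewrite dec-true (t ≟ t) refl = refl

    col₂-exchangeAt-≢ : ∀ {r} → r ≢ t → col₂ (exchangeAt t G l) r ≡ col₂ G r
    col₂-exchangeAt-≢ {r} r≢t rewrite dec-false (r ≟ t) r≢t = refl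

  act-exchangeAt : ∀ {π : Fin p → Fin p} → Injective _≡_ _≡_ π → ∀ t G i →
                   act (exchangeAt t G (π i)) π id ≐ exchangeAt t (act G π id) i
  act-exchangeAt {π} π-inj t G i =
    (λ r → cong (λ b → if b then col₂ G t else col₁ G (π r)) (does-⇔ (mk⇔ π-inj (cong π)) (π r ≟ π i) (r ≟ i))) ,
    (λ r → refl)

module _ {p q : ℕ} (q≤p : q ≤ p) where

  rowOf : Fin q → Fin p
  rowOf t = inject≤ t q≤p

  rowOf<q : ∀ t → toℕ (rowOf t) < q
  rowOf<q t = subst (_< q) (sym (Finₚ.toℕ-inject≤ t q≤p)) (Finₚ.toℕ<n t)

  fromℕ<-rowOf : ∀ t .(h : toℕ (rowOf t) < q) → fromℕ< h ≡ t
  fromℕ<-rowOf t h = Finₚ.toℕ-injective (trans (Finₚ.toℕ-fromℕ< h) (Finₚ.toℕ-inject≤ t q≤p))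

  fromℕ<-≢ : ∀ {t r} → r ≢ rowOf t → .(h : toℕ r < q) → fromℕ< h ≢ t
  fromℕ<-≢ {t} r≢row h refl =
    r≢row (Finₚ.toℕ-injective (trans (sym (Finₚ.toℕ-fromℕ< h)) (sym (Finₚ.toℕ-inject≤ (fromℕ< h) q≤p))))

module _ {n p q : ℕ} (q≤p : q ≤ p) where

  exchangeAt-own-row : ∀ t (H : Filling n p q) → SameRowContent (exchangeAt t H (rowOf q≤p t)) H
  exchangeAt-own-row t H r with r ≟ rowOf q≤p t
  ... | yes refl = rowContent-swap r (rowOf<q q≤p t)
                     (trans (col₁-exchangeAt-≡ t H r) (cong (col₂ H) (sym (fromℕ<-rowOf q≤p t _))))
                     (trans (cong (col₂ (exchangeAt t H r)) (fromℕ<-rowOf q≤p t _)) (col₂-exchangeAt-≡ t H r))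
  ... | no r≢row = rowContent-cong r (col₁-exchangeAt-≢ t H (rowOf q≤p t) r≢row)
                     (λ h → col₂-exchangeAt-≢ t H (rowOf q≤p t) (fromℕ<-≢ q≤p r≢row h))

  exchangeAt-transpose : ∀ t (H : Filling n p q) i → i ≢ rowOf q≤p t →
                         SameRowContent (exchangeAt t (act H (transpose i (rowOf q≤p t)) id) i) (exchangeAt t H i)
  exchangeAt-transpose t H i i≢j r with r ≟ i | r ≟ rowOf q≤p t
  ... | yes refl | _ =
    rowContent-cong r (trans (col₁-exchangeAt-≡ t H′ r) (sym (col₁-exchangeAt-≡ t H r)))
      (λ h → trans (col₂-exchangeAt-≢ t H′ r (fromℕ<-≢ q≤p i≢j h)) (sym (col₂-exchangeAt-≢ t H r (fromℕ<-≢ q≤p i≢j h))))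
    where H′ = act H (transpose i (rowOf q≤p t)) id
  ... | no r≢i | yes refl = rowContent-swap r (rowOf<q q≤p t)
    (begin
      col₁ (exchangeAt t H′ i) r            ≡⟨ col₁-exchangeAt-≢ t H′ i r≢i ⟩
      col₁ H (transpose i r r)              ≡⟨ cong (col₁ H) (transpose-matchʳ i r) ⟩
      col₁ H i                              ≡⟨ col₂-exchangeAt-≡ t H i ⟨
      col₂ (exchangeAt t H i) t             ≡⟨ cong (col₂ (exchangeAt t H i)) (fromℕ<-rowOf q≤p t _) ⟨
      col₂ (exchangeAt t H i) (fromℕ< _)    ∎)
    (begin
      col₂ (exchangeAt t H′ i) (fromℕ< _)   ≡⟨ cong (col₂ (exchangeAt t H′ i)) (fromℕ<-rowOf q≤p t _) ⟩
      col₂ (exchangeAt t H′ i) t            ≡⟨ col₂-exchangeAt-≡ t H′ i ⟩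
      col₁ H (transpose i r i)              ≡⟨ cong (col₁ H) (transpose-matchˡ i r) ⟩
      col₁ H r                              ≡⟨ col₁-exchangeAt-≢ t H i r≢i ⟨
      col₁ (exchangeAt t H i) r             ∎)
    where
    open ≡-Reasoning
    H′ = act H (transpose i (rowOf q≤p t)) id
  ... | no r≢i | no r≢j =
    rowContent-cong r
      (trans (col₁-exchangeAt-≢ t H′ i r≢i) (trans (cong (col₁ H) (transpose-other r≢i r≢j)) (sym (col₁-exchangeAt-≢ t H i r≢i))))
      (λ h → trans (col₂-exchangeAt-≢ t H′ i (fromℕ<-≢ q≤p r≢j h)) (sym (col₂-exchangeAt-≢ t H i (fromℕ<-≢ q≤p r≢j h))))
    where H′ = act H (transpose i (rowOf q≤p t)) id

module _ {n p q : ℕ} where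

  Σ-sgn-exchangeAt : q ≤ p → ∀ t (G S : Filling n p q) →
                     Σ (perms p) (λ π → sgn π * Σ (allFin p) (λ l → sameRows (act (exchangeAt t G l) π id) S)) ≡
                     Σ (perms p) (λ π → sgn π * sameRows (act G π id) S)
  Σ-sgn-exchangeAt q≤p t G S = begin
    Σ (perms p) (λ π → sgn π * Σ (allFin p) (λ l → sameRows (act (exchangeAt t G l) π id) S))
      ≡⟨ Σ-cong-∈ (perms p) (λ {π} π∈perms → cong (sgn π *_) (reindexed (∈-perms⇒injective π∈perms))) ⟩
    Σ (perms p) (λ π → sgn π * Σ (allFin p) (λ i → h i π))
      ≡⟨ Σ-comm-*ˡ (allFin p) (perms p) sgn (λ i π → h i π) ⟨
    Σ (allFin p) (λ i → Σ (perms p) (λ π → sgn π * h i π))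
      ≡⟨ Σ-allFin-supported p (λ i → Σ (perms p) (λ π → sgn π * h i π)) j cancelled ⟩
    Σ (perms p) (λ π → sgn π * h j π)
      ≡⟨ Σ-cong (perms p) (λ π → cong (sgn π *_) (sameRows-cong (exchangeAt-own-row q≤p t (act G π id)) S)) ⟩
    Σ (perms p) (λ π → sgn π * sameRows (act G π id) S) ∎
    where
    open ≡-Reasoning
    j : Fin p
    j = rowOf q≤p t
    h : Fin p → (Fin p → Fin p) → ℤ
    h i π = sameRows (exchangeAt t (act G π id) i) S
    reindexed : ∀ {π} → Injective _≡_ _≡_ π →
                Σ (allFin p) (λ l → sameRows (act (exchangeAt t G l) π id) S) ≡ Σ (allFin p) (λ i → h i π)
    reindexed {π} π-inj =
      trans (sym (Σ-allFin-∘-injective (λ l → sameRows (act (exchangeAt t G l) π id) S) π-inj))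
            (Σ-cong (allFin p) (λ i → sameRows-≐ (act-exchangeAt π-inj t G i) S))
    h-resp : ∀ i → h i Preserves _≗_ ⟶ _≡_
    h-resp i f≗g = sameRows-≐ (exchangeAt-cong ((λ r → cong (col₁ G) (f≗g r)) , (λ _ → refl)) t i) S
    h-invariant : ∀ i → i ≢ j → ∀ π → h i (π ∘ transpose i j) ≡ h i π
    h-invariant i i≢j π = sameRows-cong (exchangeAt-transpose q≤p t (act G π id) i i≢j) S
    cancelled : ∀ i → i ≢ j → Σ (perms p) (λ π → sgn π * h i π) ≡ 0ℤ
    cancelled i i≢j = Σ-perms-sgn-cancel (h i) (h-resp i) i≢j (h-invariant i i≢j)

  R-by-columns : ∀ (G S : Filling n p q) →
                 R G S ≡ Σ (perms q) (λ π₂ → sgn π₂ * Σ (perms p) (λ π₁ → sgn π₁ * sameRows (act G π₁ π₂) S))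
  R-by-columns G S = begin
    R G S
      ≡⟨ sumℤ-concatMap (perms p) (λ π₁ → map (term π₁) (perms q)) ⟩
    Σ (perms p) (λ π₁ → Σ (perms q) (term π₁))
      ≡⟨ Σ-cong (perms p) (λ π₁ → Σ-cong (perms q) (λ π₂ → if-*-𝟙 (does (sameRowContent? (act G π₁ π₂) S)) (sgn π₁) (sgn π₂))) ⟩
    Σ (perms p) (λ π₁ → Σ (perms q) (λ π₂ → sgn π₂ * (sgn π₁ * sameRows (act G π₁ π₂) S)))
      ≡⟨ Σ-comm-*ˡ (perms p) (perms q) sgn (λ π₁ π₂ → sgn π₁ * sameRows (act G π₁ π₂) S) ⟩
    Σ (perms q) (λ π₂ → sgn π₂ * Σ (perms p) (λ π₁ → sgn π₁ * sameRows (act G π₁ π₂) S)) ∎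
    where
    open ≡-Reasoning
    term : (Fin p → Fin p) → (Fin q → Fin q) → ℤ
    term π₁ π₂ = if does (sameRowContent? (act G π₁ π₂) S) then sgn π₁ * sgn π₂ else 0ℤ
    if-*-𝟙 : ∀ b x y → (if b then x * y else 0ℤ) ≡ y * (x * 𝟙 b)
    if-*-𝟙 true  x y = trans (ℤₚ.*-comm x y) (cong (y *_) (sym (ℤₚ.*-identityʳ x)))
    if-*-𝟙 false x y = sym (trans (cong (y *_) (ℤₚ.*-zeroʳ x)) (ℤₚ.*-zeroʳ y))

  act-exchange : ∀ (hq : 0 < q) (F : Filling n p q) {π₂} → Injective _≡_ _≡_ π₂ → ∀ {t} → π₂ t ≡ fromℕ< hq →
                 ∀ l π₁ → act (exchange hq F l) π₁ π₂ ≐ act (exchangeAt t (act F id π₂) l) π₁ id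
  act-exchange hq F {π₂} π₂-inj {t} π₂t≡top l π₁ = ≐-trans (act-cong exchange≐exchangeAt π₁ π₂) (col₁-≗ , col₂-≗)
    where
    top = fromℕ< hq
    exchange≐exchangeAt : exchange hq F l ≐ exchangeAt top F l
    exchange≐exchangeAt = col₁-eq , col₂-eq
      where
      col₁-eq : ∀ r → col₁ (exchange hq F l) r ≡ col₁ (exchangeAt top F l) r
      col₁-eq r with r ≟ l
      ... | yes _ = refl
      ... | no  _ = refl
      col₂-eq : ∀ r → col₂ (exchange hq F l) r ≡ col₂ (exchangeAt top F l) r
      col₂-eq r with r ≟ top
      ... | yes _ = refl
      ... | no  _ = refl
    col₁-≗ : ∀ r → col₁ (exchangeAt top F l) (π₁ r) ≡ col₁ (exchangeAt t (act F id π₂) l) (π₁ r)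
    col₁-≗ r = cong (λ x → if does (π₁ r ≟ l) then col₂ F x else col₁ F (π₁ r)) (sym π₂t≡top)
    col₂-≗ : ∀ r → col₂ (exchangeAt top F l) (π₂ r) ≡ col₂ (exchangeAt t (act F id π₂) l) r
    col₂-≗ r = cong (λ b → if b then col₁ F l else col₂ F (π₂ r))
                    (does-⇔ (mk⇔ (λ π₂r≡top → π₂-inj (trans π₂r≡top (sym π₂t≡top))) (λ { refl → π₂t≡top })) (π₂ r ≟ top) (r ≟ t))

  Σ-R-exchange : q ≤ p → (hq : 0 < q) (F S : Filling n p q) → Σ (allFin p) (λ l → R (exchange hq F l) S) ≡ R F S
  Σ-R-exchange q≤p hq F S = begin
    Σ (allFin p) (λ l → R (exchange hq F l) S)
      ≡⟨ Σ-cong (allFin p) (λ l → R-by-columns (exchange hq F l) S) ⟩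
    Σ (allFin p) (λ l → Σ (perms q) (λ π₂ → sgn π₂ * Σ (perms p) (λ π₁ → sgn π₁ * χ l π₁ π₂)))
      ≡⟨ Σ-comm-*ˡ (allFin p) (perms q) sgn (λ l π₂ → Σ (perms p) (λ π₁ → sgn π₁ * χ l π₁ π₂)) ⟩
    Σ (perms q) (λ π₂ → sgn π₂ * Σ (allFin p) (λ l → Σ (perms p) (λ π₁ → sgn π₁ * χ l π₁ π₂)))
      ≡⟨ Σ-cong (perms q) (λ π₂ → cong (sgn π₂ *_) (Σ-comm-*ˡ (allFin p) (perms p) sgn (λ l π₁ → χ l π₁ π₂))) ⟩
    Σ (perms q) (λ π₂ → sgn π₂ * Σ (perms p) (λ π₁ → sgn π₁ * Σ (allFin p) (λ l → χ l π₁ π₂)))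
      ≡⟨ Σ-cong-∈ (perms q) (λ {π₂} π₂∈perms → cong (sgn π₂ *_) (column₁ (∈-perms⇒injective π₂∈perms))) ⟩
    Σ (perms q) (λ π₂ → sgn π₂ * Σ (perms p) (λ π₁ → sgn π₁ * sameRows (act F π₁ π₂) S))
      ≡⟨ R-by-columns F S ⟨
    R F S ∎
    where
    open ≡-Reasoning
    χ : Fin p → (Fin p → Fin p) → (Fin q → Fin q) → ℤ
    χ l π₁ π₂ = sameRows (act (exchange hq F l) π₁ π₂) S
    column₁ : ∀ {π₂} → Injective _≡_ _≡_ π₂ →
              Σ (perms p) (λ π₁ → sgn π₁ * Σ (allFin p) (λ l → χ l π₁ π₂)) ≡
              Σ (perms p) (λ π₁ → sgn π₁ * sameRows (act F π₁ π₂) S)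
    column₁ {π₂} π₂-inj with (t , π₂t≡top) ← injective⇒surjective π₂-inj (fromℕ< hq) =
      trans (Σ-cong (perms p) (λ π₁ → cong (sgn π₁ *_) (Σ-cong (allFin p) (λ l →
               sameRows-≐ (act-exchange hq F π₂-inj π₂t≡top l π₁) S))))
            (Σ-sgn-exchangeAt q≤p t (act F id π₂) S)

proposition3p15 : (n : ℕ) → 2 ≤ n → (p q : ℕ) → (hq : 0 < q) → q ≤ p →
    (z : Fin n → ℕ) → sumℕ (map z (allFin n)) ≡ p + q →
    (F S : Filling n p q) → Cardinal F → Cardinal S →
    (∀ v → content F v ≡ z v) → (∀ v → content S v ≡ z v) →
    R F S - sumℤ (map (λ l → R (exchange hq F l) S) (allFin p)) ≡ 0ℤ
proposition3p15 n _ p q hq q≤p z _ F S _ _ _ _ =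
  trans (cong (λ x → R F S - x) (Σ-R-exchange q≤p hq F S)) (ℤₚ.+-inverseʳ (R F S))
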